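{- Let $\sigma\in\mathfrak{S}_n$, let $F=\{i:\sigma(i)>i\}=\{y_1<y_2<\dots<y_l\}$, $F'=\{i:i>\sigma^{ -1}(i)\}$, $G'=\{i:i<\sigma^{ -1}(i)\}$, and let $j$ with $1\le j\le l$ be such that $y_j\in F\cap G'$. Then \[ \#\{u\in F'\setminus\{\sigma(y_l),\dots,\sigma(y_{j+1})\}: u>y_j\}=h_{y_j-1}+1=h_{y_j}, \] where $h_i$ denotes the height after step $i$ of the Motzkin path associated to $\sigma$.
   Context: $\mathfrak{S}_n$ is the set of permutations of $[n]$. The Motzkin path associated to $\sigma$ has steps $s_1,\dots,s_n$, starting at height $h_0=0$: $s_i$ is a rise (height $+1$) if $i$ is a cycle valley ($\sigma^{ -1}(i)>i<\sigma(i)$), a fall (height $-1$) if $i$ is a cycle peak ($\sigma^{ -1}(i)<i>\sigma(i)$), and a level step otherwise; $h_i$ is the height after step $i$. (Equivalently $h_i=\#\{j\le i:\sigma(j)>i\}$.) -}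

module Defs where

open import Data.Nat using (ℕ; zero; suc)
import Data.Nat
import Data.Fin
open import Data.Fin using (Fin; toℕ; _<_; _<?_)
open import Data.Fin.Properties using (any?)
open import Data.Fin.Permutation using (Permutation′; _⟨$⟩ʳ_; _⟨$⟩ˡ_)
open import Data.Integer using (ℤ; +_; -[1+_]; _+_)
open import Data.List using (List; length; filter; map; foldr)
open import Data.List.Base using (allFin)
open import Data.Product using (∃; _×_; _,_)
open import Relation.Nullary using (¬_; Dec; yes; no)
open import Relation.Nullary.Decidable using (_×-dec_; ¬?)
open import Relation.Unary using (Decidable)
open import Relation.Binary.PropositionalEquality using (_≡_)

-- Convention: [n] = {1,…,n} is represented by Fin n = {0,…,n-1};
-- the element i ∈ [n] corresponds to the Fin element of value i-1.
-- This shift preserves the order, so all comparisons are unchanged.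

count : ∀ {n} {P : Fin n → Set} → Decidable P → ℕ
count {n} P? = length (filter P? (allFin n))

module _ {n : ℕ} (σ : Permutation′ n) where

  CycleValley : Fin n → Set
  CycleValley i = (i < (σ ⟨$⟩ˡ i)) × (i < (σ ⟨$⟩ʳ i))

  CyclePeak : Fin n → Set
  CyclePeak i = ((σ ⟨$⟩ˡ i) < i) × ((σ ⟨$⟩ʳ i) < i)

  step : Fin n → ℤ
  step i with (i <? (σ ⟨$⟩ˡ i)) ×-dec (i <? (σ ⟨$⟩ʳ i))
  ... | yes _ = + 1
  ... | no _ with ((σ ⟨$⟩ˡ i) <? i) ×-dec ((σ ⟨$⟩ʳ i) <? i)
  ...   | yes _ = -[1+ 0 ]
  ...   | no _ = + 0

  -- height h_k after the first k steps (h_0 = 0); with the Fin shift,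
  -- the first k steps are those at Fin positions of value < k.
  height : ℕ → ℤ
  height k = foldr _+_ (+ 0) (map step (filter (λ i → Data.Nat._<?_ (toℕ i) k) (allFin n)))

  InF : Fin n → Set
  InF i = i < (σ ⟨$⟩ʳ i)

  InF? : Decidable InF
  InF? i = i <? (σ ⟨$⟩ʳ i)

  InF′ : Fin n → Set
  InF′ i = (σ ⟨$⟩ˡ i) < i

  InF′? : Decidable InF′
  InF′? i = (σ ⟨$⟩ˡ i) <? i

  InG′ : Fin n → Set
  InG′ i = i < (σ ⟨$⟩ˡ i)

  -- For y = y_j ∈ F: u ∈ {σ(y_{j+1}),…,σ(y_l)}, i.e. u = σ(y') for some y' ∈ F with y' > y
  InImageLaterF : Fin n → Fin n → Set
  InImageLaterF y u = ∃ λ y′ → (InF y′ × y < y′) × (σ ⟨$⟩ʳ y′ ≡ u)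

  InImageLaterF? : (y : Fin n) → Decidable (InImageLaterF y)
  InImageLaterF? y u = any? (λ y′ → (InF? y′ ×-dec (y <? y′)) ×-dec (σ ⟨$⟩ʳ y′ Data.Fin.≟ u))

  Counted : Fin n → Fin n → Set
  Counted y u = (InF′ u × ¬ InImageLaterF y u) × y < u

  Counted? : (y : Fin n) → Decidable (Counted y)
  Counted? y u = (InF′? u ×-dec ¬? (InImageLaterF? y u)) ×-dec (y <? u)

-- h_k counts the arcs j ↦ σ(j) that start among the first k positions and
-- end beyond them.  Passing from k to k+1 the arc leaving position k+1 is
-- added if it goes up and the arc entering it is removed if it came from
-- below, which is exactly the Motzkin step.  The set counted in the lemma is
-- the set of endpoints of arcs straddling the gap after y_j, so it has h_{y_j} elements,
-- and y_j is a cycle valley, so h_{y_j} = h_{y_j − 1} + 1.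
module Submission where

open import Defs
open import Level using (Level)
import Data.Nat
open import Data.Nat using (ℕ; zero; suc; _≤_; _≟_; s≤s)
  renaming (_<_ to _<ℕ_; _<?_ to _<ℕ?_; _≤?_ to _≤ℕ?_)
open import Data.Nat.Properties
  using (<-cmp; <-≤-connex; ≤⇒≯; <-irrefl; <-asym; <⇒≢; >⇒≢; <⇒≱; <⇒≤; ≤-refl; n<1+n; ≤∧≢⇒<; ≮⇒≥; ≤-<-trans; m<1+n⇒m≤n)
open import Data.Fin using (Fin; toℕ; _<_; _<?_; fromℕ<; punchIn)
open import Data.Fin.Properties using (toℕ-injective; toℕ-fromℕ<; toℕ<n; punchInᵢ≢i)
open import Data.Fin.Permutation using (Permutation′; _⟨$⟩ʳ_; _⟨$⟩ˡ_; inverseˡ; inverseʳ)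
open import Data.Integer using (ℤ; +_; -[1+_]; _+_)
open import Data.Integer.Properties
  using (+-assoc; +-identityʳ; +-identityˡ; +-0-abelianGroup; +-0-commutativeMonoid)
open import Algebra.Properties.AbelianGroup +-0-abelianGroup using (∙-cancelʳ)
open import Algebra.Properties.CommutativeMonoid.Sum +-0-commutativeMonoid
  using (sum; ∑-distrib-+; sum-cong-≗; sum-replicate-zero; sum-remove)
open import Data.Bool using (if_then_else_)
open import Data.List using (List; []; _∷_; length; filter; map; foldr; tabulate; allFin)
open import Data.List.Properties using (filter-≐)
open import Data.Product using (_×_; _,_; proj₁; proj₂)
open import Data.Sum using (inj₁; inj₂)
open import Function using (_∘_; id)
open import Function.Bundles using (mk⇔)
open import Relation.Binary.Definitions using (tri<; tri≈; tri>)
open import Relation.Binary.PropositionalEquality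
  using (_≡_; _≢_; refl; sym; trans; cong; cong₂; subst; module ≡-Reasoning)
open import Relation.Nullary using (¬_; Dec; does; yes; no; contradiction)
open import Relation.Nullary.Decidable using (_×-dec_; dec-true; dec-false; does-⇔)
open import Relation.Unary using (Decidable; _≐_; _⊆_)

open ≡-Reasoning

private
  variable
    a b : Level
    P : Set a
    Q : Set b
    n : ℕ

when : Dec P → ℤ → ℤ
when P? x = if does P? then x else + 0

𝟙 : Dec P → ℤ
𝟙 P? = when P? (+ 1)

when-yes : (P? : Dec P) {x : ℤ} → P → when P? x ≡ x
when-yes P? p rewrite dec-true P? p = refl

when-no : (P? : Dec P) {x : ℤ} → ¬ P → when P? x ≡ + 0
when-no P? ¬p rewrite dec-false P? ¬p = refl

when-⇔ : (P? : Dec P) (Q? : Dec Q) {x : ℤ} → (P → Q) → (Q → P) → when P? x ≡ when Q? x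
when-⇔ P? Q? {x} P→Q Q→P = cong (λ t → if t then x else + 0) (does-⇔ (mk⇔ P→Q Q→P) P? Q?)

when-×-yesˡ : (P? : Dec P) (Q? : Dec Q) {x : ℤ} → P → when (P? ×-dec Q?) x ≡ when Q? x
when-×-yesˡ P? Q? p rewrite dec-true P? p = refl

when-≤-split : (m k : ℕ) {x : ℤ} → when (m ≤ℕ? k) x ≡ when (m <ℕ? k) x + when (m ≟ k) x
when-≤-split m k {x} with <-cmp m k
... | tri< m<k _ _ = begin
  when (m ≤ℕ? k) x                      ≡⟨ when-yes (m ≤ℕ? k) (<⇒≤ m<k) ⟩
  x                                     ≡⟨ sym (+-identityʳ x) ⟩
  x + + 0                               ≡⟨ sym (cong₂ _+_ (when-yes (m <ℕ? k) m<k) (when-no (m ≟ k) (<⇒≢ m<k))) ⟩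
  when (m <ℕ? k) x + when (m ≟ k) x     ∎
... | tri≈ _ refl _ = begin
  when (m ≤ℕ? m) x                      ≡⟨ when-yes (m ≤ℕ? m) ≤-refl ⟩
  x                                     ≡⟨ sym (+-identityˡ x) ⟩
  + 0 + x                               ≡⟨ sym (cong₂ _+_ (when-no (m <ℕ? m) (<-irrefl refl)) (when-yes (m ≟ m) refl)) ⟩
  when (m <ℕ? m) x + when (m ≟ m) x     ∎
... | tri> _ _ k<m = begin
  when (m ≤ℕ? k) x                      ≡⟨ when-no (m ≤ℕ? k) (<⇒≱ k<m) ⟩
  + 0                                   ≡⟨ sym (cong₂ _+_ (when-no (m <ℕ? k) (<-asym k<m)) (when-no (m ≟ k) (>⇒≢ k<m))) ⟩
  when (m <ℕ? k) x + when (m ≟ k) x     ∎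

foldr-+-map-filter : {A : Set} {R : A → Set} (R? : Decidable R) (f : A → ℤ) (xs : List A) →
  foldr _+_ (+ 0) (map f (filter R? xs)) ≡ foldr _+_ (+ 0) (map (λ x → when (R? x) (f x)) xs)
foldr-+-map-filter R? f [] = refl
foldr-+-map-filter R? f (x ∷ xs) with R? x
... | yes _ = cong (_+_ (f x)) (foldr-+-map-filter R? f xs)
... | no _  = trans (foldr-+-map-filter R? f xs) (sym (+-identityˡ _))

length-filter-as-foldr : {A : Set} {R : A → Set} (R? : Decidable R) (xs : List A) →
  + length (filter R? xs) ≡ foldr _+_ (+ 0) (map (𝟙 ∘ R?) xs)
length-filter-as-foldr R? [] = refl
length-filter-as-foldr R? (x ∷ xs) with R? x
... | yes _ = cong (_+_ (+ 1)) (length-filter-as-foldr R? xs)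
... | no _  = trans (length-filter-as-foldr R? xs) (sym (+-identityˡ _))

foldr-+-map-tabulate : {A : Set} (f : A → ℤ) (g : Fin n → A) →
  foldr _+_ (+ 0) (map f (tabulate g)) ≡ sum (f ∘ g)
foldr-+-map-tabulate {zero}  f g = refl
foldr-+-map-tabulate {suc n} f g = cong (_+_ (f (g Data.Fin.zero))) (foldr-+-map-tabulate f (g ∘ Data.Fin.suc))

count-as-sum : {R : Fin n → Set} (R? : Decidable R) → + count R? ≡ sum (𝟙 ∘ R?)
count-as-sum {n} R? = trans (length-filter-as-foldr R? (allFin n)) (foldr-+-map-tabulate (𝟙 ∘ R?) id)

sum-zero : (f : Fin n → ℤ) → (∀ i → f i ≡ + 0) → sum f ≡ + 0
sum-zero {n} f f≗0 = trans (sum-cong-≗ f≗0) (sum-replicate-zero n)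

sum-δ : (f : Fin n → ℤ) (i : Fin n) → (∀ j → j ≢ i → f j ≡ + 0) → sum f ≡ f i
sum-δ {suc n} f i vanishes = begin
  sum f                       ≡⟨ sum-remove f ⟩
  f i + sum (f ∘ punchIn i)   ≡⟨ cong (_+_ (f i)) (sum-zero _ (λ j → vanishes _ (punchInᵢ≢i i j))) ⟩
  f i + + 0                   ≡⟨ +-identityʳ (f i) ⟩
  f i                         ∎

sum-prefix-suc : (f : Fin n → ℤ) (i : Fin n) →
  sum (λ j → when (toℕ j <ℕ? suc (toℕ i)) (f j)) ≡ sum (λ j → when (toℕ j <ℕ? toℕ i) (f j)) + f i
sum-prefix-suc f i = begin
  sum (λ j → when (toℕ j <ℕ? suc k) (f j))
    ≡⟨ sum-cong-≗ split ⟩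
  sum (λ j → when (toℕ j <ℕ? k) (f j) + when (toℕ j ≟ k) (f j))
    ≡⟨ ∑-distrib-+ (λ j → when (toℕ j <ℕ? k) (f j)) (λ j → when (toℕ j ≟ k) (f j)) ⟩
  below + sum (λ j → when (toℕ j ≟ k) (f j))
    ≡⟨ cong (_+_ below) (sum-δ _ i (λ j j≢i → when-no (toℕ j ≟ k) (j≢i ∘ toℕ-injective))) ⟩
  below + when (k ≟ k) (f i)
    ≡⟨ cong (_+_ below) (when-yes (k ≟ k) refl) ⟩
  below + f i
    ∎
  where
  k : ℕ
  k = toℕ i

  below : ℤ
  below = sum (λ j → when (toℕ j <ℕ? k) (f j))

  split : ∀ j → when (toℕ j <ℕ? suc k) (f j) ≡ when (toℕ j <ℕ? k) (f j) + when (toℕ j ≟ k) (f j)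
  split j = trans (when-⇔ (toℕ j <ℕ? suc k) (toℕ j ≤ℕ? k) m<1+n⇒m≤n s≤s) (when-≤-split (toℕ j) k)

-- The arc a ↦ b as the gap moves past position k: it starts straddling when
-- a = k < b and stops when a < k = b.
straddle-shift : (a b k : ℕ) →
  𝟙 ((a <ℕ? suc k) ×-dec (suc k ≤ℕ? b)) + 𝟙 ((a <ℕ? k) ×-dec (k ≟ b))
    ≡ 𝟙 ((a <ℕ? k) ×-dec (k ≤ℕ? b)) + 𝟙 ((a ≟ k) ×-dec (k <ℕ? b))
straddle-shift a b k with <-cmp a k
... | tri< a<k _ _ = begin
  𝟙 ((a <ℕ? suc k) ×-dec (suc k ≤ℕ? b)) + 𝟙 ((a <ℕ? k) ×-dec (k ≟ b))
    ≡⟨ cong₂ _+_ (when-×-yesˡ (a <ℕ? suc k) (k <ℕ? b) (<⇒≤ (s≤s a<k)))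
                 (when-×-yesˡ (a <ℕ? k) (k ≟ b) a<k) ⟩
  𝟙 (k <ℕ? b) + 𝟙 (k ≟ b)
    ≡⟨ sym (when-≤-split k b) ⟩
  𝟙 (k ≤ℕ? b)
    ≡⟨ sym (+-identityʳ _) ⟩
  𝟙 (k ≤ℕ? b) + + 0
    ≡⟨ sym (cong₂ _+_ (when-×-yesˡ (a <ℕ? k) (k ≤ℕ? b) a<k)
                      (when-no ((a ≟ k) ×-dec (k <ℕ? b)) (<⇒≢ a<k ∘ proj₁))) ⟩
  𝟙 ((a <ℕ? k) ×-dec (k ≤ℕ? b)) + 𝟙 ((a ≟ k) ×-dec (k <ℕ? b))
    ∎
... | tri≈ _ refl _ = begin
  𝟙 ((a <ℕ? suc a) ×-dec (suc a ≤ℕ? b)) + 𝟙 ((a <ℕ? a) ×-dec (a ≟ b))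
    ≡⟨ cong₂ _+_ (when-×-yesˡ (a <ℕ? suc a) (a <ℕ? b) (n<1+n a))
                 (when-no ((a <ℕ? a) ×-dec (a ≟ b)) (<-irrefl refl ∘ proj₁)) ⟩
  𝟙 (a <ℕ? b) + + 0
    ≡⟨ trans (+-identityʳ (𝟙 (a <ℕ? b))) (sym (+-identityˡ (𝟙 (a <ℕ? b)))) ⟩
  + 0 + 𝟙 (a <ℕ? b)
    ≡⟨ sym (cong₂ _+_ (when-no ((a <ℕ? a) ×-dec (a ≤ℕ? b)) (<-irrefl refl ∘ proj₁))
                      (when-×-yesˡ (a ≟ a) (a <ℕ? b) refl)) ⟩
  𝟙 ((a <ℕ? a) ×-dec (a ≤ℕ? b)) + 𝟙 ((a ≟ a) ×-dec (a <ℕ? b))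
    ∎
... | tri> _ _ k<a = begin
  𝟙 ((a <ℕ? suc k) ×-dec (suc k ≤ℕ? b)) + 𝟙 ((a <ℕ? k) ×-dec (k ≟ b))
    ≡⟨ cong₂ _+_ (when-no ((a <ℕ? suc k) ×-dec (suc k ≤ℕ? b)) (<⇒≱ k<a ∘ m<1+n⇒m≤n ∘ proj₁))
                 (when-no ((a <ℕ? k) ×-dec (k ≟ b)) (<-asym k<a ∘ proj₁)) ⟩
  + 0
    ≡⟨ sym (cong₂ _+_ (when-no ((a <ℕ? k) ×-dec (k ≤ℕ? b)) (<-asym k<a ∘ proj₁))
                      (when-no ((a ≟ k) ×-dec (k <ℕ? b)) (>⇒≢ k<a ∘ proj₁))) ⟩
  𝟙 ((a <ℕ? k) ×-dec (k ≤ℕ? b)) + 𝟙 ((a ≟ k) ×-dec (k <ℕ? b))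
    ∎

module _ {n : ℕ} (σ : Permutation′ n) where

  Straddles : ℕ → Fin n → Set
  Straddles k u = toℕ (σ ⟨$⟩ˡ u) <ℕ k × k ≤ toℕ u

  Straddles? : (k : ℕ) → Decidable (Straddles k)
  Straddles? k u = (toℕ (σ ⟨$⟩ˡ u) <ℕ? k) ×-dec (k ≤ℕ? toℕ u)

  step-valley : {i : Fin n} → CycleValley σ i → step σ i ≡ + 1
  step-valley {i} valley with (i <? (σ ⟨$⟩ˡ i)) ×-dec (i <? (σ ⟨$⟩ʳ i))
  ... | yes _      = refl
  ... | no ¬valley = contradiction valley ¬valley

  step-peak : {i : Fin n} → CyclePeak σ i → step σ i ≡ -[1+ 0 ]
  step-peak {i} peak@(σ⁻¹i<i , _) with (i <? (σ ⟨$⟩ˡ i)) ×-dec (i <? (σ ⟨$⟩ʳ i))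
  ... | yes (i<σ⁻¹i , _) = contradiction σ⁻¹i<i (<-asym i<σ⁻¹i)
  ... | no _ with ((σ ⟨$⟩ˡ i) <? i) ×-dec ((σ ⟨$⟩ʳ i) <? i)
  ...   | yes _     = refl
  ...   | no ¬peak  = contradiction peak ¬peak

  step-level : {i : Fin n} → ¬ CycleValley σ i → ¬ CyclePeak σ i → step σ i ≡ + 0
  step-level {i} ¬valley ¬peak with (i <? (σ ⟨$⟩ˡ i)) ×-dec (i <? (σ ⟨$⟩ʳ i))
  ... | yes valley = contradiction valley ¬valley
  ... | no _ with ((σ ⟨$⟩ˡ i) <? i) ×-dec ((σ ⟨$⟩ʳ i) <? i)
  ...   | yes peak = contradiction peak ¬peak
  ...   | no _     = refl

  fixedˡ⇒fixedʳ : {i : Fin n} → σ ⟨$⟩ˡ i ≡ i → σ ⟨$⟩ʳ i ≡ i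
  fixedˡ⇒fixedʳ {i} e = trans (cong (σ ⟨$⟩ʳ_) (sym e)) (inverseʳ σ)

  fixedʳ⇒fixedˡ : {i : Fin n} → σ ⟨$⟩ʳ i ≡ i → σ ⟨$⟩ˡ i ≡ i
  fixedʳ⇒fixedˡ {i} e = trans (cong (σ ⟨$⟩ˡ_) (sym e)) (inverseˡ σ)

  step+𝟙[F′]≡𝟙[F] : (i : Fin n) → step σ i + 𝟙 (InF′? σ i) ≡ 𝟙 (InF? σ i)
  step+𝟙[F′]≡𝟙[F] i with <-cmp (toℕ (σ ⟨$⟩ˡ i)) (toℕ i)
  ... | tri< σ⁻¹i<i _ _ with <-≤-connex (toℕ i) (toℕ (σ ⟨$⟩ʳ i))
  ...   | inj₁ i<σi = trans
          (cong₂ _+_ (step-level (λ (i<σ⁻¹i , _) → <-asym i<σ⁻¹i σ⁻¹i<i) (λ (_ , σi<i) → <-asym i<σi σi<i))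
                     (when-yes (InF′? σ i) σ⁻¹i<i))
          (sym (when-yes (InF? σ i) i<σi))
  ...   | inj₂ σi≤i = trans
          (cong₂ _+_ (step-peak (σ⁻¹i<i , σi<i)) (when-yes (InF′? σ i) σ⁻¹i<i))
          (sym (when-no (InF? σ i) (<-asym σi<i)))
    where
    σi<i : (σ ⟨$⟩ʳ i) < i
    σi<i = ≤∧≢⇒< σi≤i (λ σi≡i → <⇒≢ σ⁻¹i<i (cong toℕ (fixedʳ⇒fixedˡ (toℕ-injective σi≡i))))
  step+𝟙[F′]≡𝟙[F] i | tri≈ _ σ⁻¹i≡i _ = trans
    (cong₂ _+_ (step-level (λ (i<σ⁻¹i , _) → <-irrefl (sym σ⁻¹i≡i) i<σ⁻¹i) (λ (σ⁻¹i<i , _) → <-irrefl σ⁻¹i≡i σ⁻¹i<i))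
               (when-no (InF′? σ i) (<-irrefl σ⁻¹i≡i)))
    (sym (when-no (InF? σ i) (<-irrefl (sym (cong toℕ (fixedˡ⇒fixedʳ (toℕ-injective σ⁻¹i≡i)))))))
  step+𝟙[F′]≡𝟙[F] i | tri> _ _ i<σ⁻¹i with <-≤-connex (toℕ i) (toℕ (σ ⟨$⟩ʳ i))
  ...   | inj₁ i<σi = trans
          (cong₂ _+_ (step-valley (i<σ⁻¹i , i<σi)) (when-no (InF′? σ i) (<-asym i<σ⁻¹i)))
          (sym (when-yes (InF? σ i) i<σi))
  ...   | inj₂ σi≤i = trans
          (cong₂ _+_ (step-level (≤⇒≯ σi≤i ∘ proj₂) (<-asym i<σ⁻¹i ∘ proj₁)) (when-no (InF′? σ i) (<-asym i<σ⁻¹i)))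
          (sym (when-no (InF? σ i) (≤⇒≯ σi≤i)))

  𝟙[F′]-as-sum : (i : Fin n) →
    𝟙 (InF′? σ i) ≡ sum (λ u → 𝟙 ((toℕ (σ ⟨$⟩ˡ u) <ℕ? toℕ i) ×-dec (toℕ i ≟ toℕ u)))
  𝟙[F′]-as-sum i = sym (trans
    (sum-δ _ i (λ u u≢i → when-no ((_ <ℕ? toℕ i) ×-dec (toℕ i ≟ toℕ u)) (u≢i ∘ sym ∘ toℕ-injective ∘ proj₂)))
    (when-⇔ ((_ <ℕ? toℕ i) ×-dec (toℕ i ≟ toℕ i)) (InF′? σ i) proj₁ (_, refl)))

  𝟙[F]-as-sum : (i : Fin n) →
    𝟙 (InF? σ i) ≡ sum (λ u → 𝟙 ((toℕ (σ ⟨$⟩ˡ u) ≟ toℕ i) ×-dec (toℕ i <ℕ? toℕ u)))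
  𝟙[F]-as-sum i = sym (trans
    (sum-δ _ (σ ⟨$⟩ʳ i) (λ u u≢σi → when-no ((toℕ (σ ⟨$⟩ˡ u) ≟ toℕ i) ×-dec (_ <ℕ? toℕ u))
      (λ (σ⁻¹u≡i , _) → u≢σi (trans (sym (inverseʳ σ)) (cong (σ ⟨$⟩ʳ_) (toℕ-injective σ⁻¹u≡i))))))
    (when-×-yesˡ (toℕ (σ ⟨$⟩ˡ (σ ⟨$⟩ʳ i)) ≟ toℕ i) (InF? σ i) (cong toℕ (inverseˡ σ))))

  count-Straddles-suc : (i : Fin n) →
    + count (Straddles? (suc (toℕ i))) + 𝟙 (InF′? σ i) ≡ + count (Straddles? (toℕ i)) + 𝟙 (InF? σ i)
  count-Straddles-suc i = begin
    + count (Straddles? (suc k)) + 𝟙 (InF′? σ i)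
      ≡⟨ cong₂ _+_ (count-as-sum (Straddles? (suc k))) (𝟙[F′]-as-sum i) ⟩
    sum (𝟙 ∘ Straddles? (suc k)) + sum arriving
      ≡⟨ sym (∑-distrib-+ (𝟙 ∘ Straddles? (suc k)) arriving) ⟩
    sum (λ u → 𝟙 (Straddles? (suc k) u) + arriving u)
      ≡⟨ sum-cong-≗ (λ u → straddle-shift (toℕ (σ ⟨$⟩ˡ u)) (toℕ u) k) ⟩
    sum (λ u → 𝟙 (Straddles? k u) + leaving u)
      ≡⟨ ∑-distrib-+ (𝟙 ∘ Straddles? k) leaving ⟩
    sum (𝟙 ∘ Straddles? k) + sum leaving
      ≡⟨ sym (cong₂ _+_ (count-as-sum (Straddles? k)) (𝟙[F]-as-sum i)) ⟩
    + count (Straddles? k) + 𝟙 (InF? σ i)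
      ∎
    where
    k : ℕ
    k = toℕ i

    arriving leaving : Fin n → ℤ
    arriving u = 𝟙 ((toℕ (σ ⟨$⟩ˡ u) <ℕ? k) ×-dec (k ≟ toℕ u))
    leaving u = 𝟙 ((toℕ (σ ⟨$⟩ˡ u) ≟ k) ×-dec (k <ℕ? toℕ u))

  height-as-sum : (k : ℕ) → height σ k ≡ sum (λ j → when (toℕ j <ℕ? k) (step σ j))
  height-as-sum k = trans (foldr-+-map-filter (λ j → toℕ j <ℕ? k) (step σ) (allFin n))
                          (foldr-+-map-tabulate (λ j → when (toℕ j <ℕ? k) (step σ j)) id)

  height-suc : (i : Fin n) → height σ (suc (toℕ i)) ≡ height σ (toℕ i) + step σ i
  height-suc i = begin
    height σ (suc (toℕ i))                                     ≡⟨ height-as-sum (suc (toℕ i)) ⟩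
    sum (λ j → when (toℕ j <ℕ? suc (toℕ i)) (step σ j))        ≡⟨ sum-prefix-suc (step σ) i ⟩
    sum (λ j → when (toℕ j <ℕ? toℕ i) (step σ j)) + step σ i   ≡⟨ cong (λ h → h + step σ i) (sym (height-as-sum (toℕ i))) ⟩
    height σ (toℕ i) + step σ i                                ∎

  height≡count-Straddles : (k : ℕ) → k ≤ n → height σ k ≡ + count (Straddles? k)
  height≡count-Straddles zero _ = begin
    height σ 0                                  ≡⟨ height-as-sum 0 ⟩
    sum (λ j → when (toℕ j <ℕ? 0) (step σ j))   ≡⟨ sum-zero _ (λ j → when-no (toℕ j <ℕ? 0) {step σ j} λ ()) ⟩
    + 0                                         ≡⟨ sym (sum-zero _ (λ u → when-no (Straddles? 0 u) {+ 1} λ ())) ⟩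
    sum (𝟙 ∘ Straddles? 0)                      ≡⟨ sym (count-as-sum (Straddles? 0)) ⟩
    + count (Straddles? 0)                      ∎
  height≡count-Straddles (suc k) k<n with fromℕ< k<n | toℕ-fromℕ< k<n
  ... | i | refl = ∙-cancelʳ (𝟙 (InF′? σ i)) _ _ (begin
    height σ (suc k) + 𝟙 (InF′? σ i)             ≡⟨ cong (λ h → h + 𝟙 (InF′? σ i)) (height-suc i) ⟩
    height σ k + step σ i + 𝟙 (InF′? σ i)        ≡⟨ +-assoc (height σ k) (step σ i) (𝟙 (InF′? σ i)) ⟩
    height σ k + (step σ i + 𝟙 (InF′? σ i))      ≡⟨ cong₂ _+_ (height≡count-Straddles k (<⇒≤ k<n)) (step+𝟙[F′]≡𝟙[F] i) ⟩
    + count (Straddles? k) + 𝟙 (InF? σ i)        ≡⟨ sym (count-Straddles-suc i) ⟩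
    + count (Straddles? (suc k)) + 𝟙 (InF′? σ i) ∎)

  Counted≐Straddles : (y : Fin n) → Counted σ y ≐ Straddles (suc (toℕ y))
  Counted≐Straddles y = counted⇒straddles , straddles⇒counted
    where
    counted⇒straddles : Counted σ y ⊆ Straddles (suc (toℕ y))
    counted⇒straddles {u} ((σ⁻¹u<u , u∉σ[F>y]) , y<u) = s≤s (≮⇒≥ σ⁻¹u≯y) , y<u
      where
      σ⁻¹u≯y : ¬ y < (σ ⟨$⟩ˡ u)
      σ⁻¹u≯y y<σ⁻¹u = u∉σ[F>y] (σ ⟨$⟩ˡ u , (subst ((σ ⟨$⟩ˡ u) <_) (sym (inverseʳ σ)) σ⁻¹u<u , y<σ⁻¹u) , inverseʳ σ)

    straddles⇒counted : Straddles (suc (toℕ y)) ⊆ Counted σ y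
    straddles⇒counted {u} (σ⁻¹u≤y , y<u) = (≤-<-trans (m<1+n⇒m≤n σ⁻¹u≤y) y<u , u∉σ[F>y]) , y<u
      where
      u∉σ[F>y] : ¬ InImageLaterF σ y u
      u∉σ[F>y] (y′ , (_ , y<y′) , σy′≡u) =
        <⇒≱ y<y′ (subst (λ v → toℕ v ≤ toℕ y) (trans (cong (σ ⟨$⟩ˡ_) (sym σy′≡u)) (inverseˡ σ)) (m<1+n⇒m≤n σ⁻¹u≤y))

lemma6p6 : (n : ℕ) (σ : Permutation′ n) (y : Fin n) → InF σ y → InG′ σ y →
    ((+ count (Counted? σ y)) ≡ height σ (toℕ y) + + 1)
    × (height σ (toℕ y) + + 1 ≡ height σ (Data.Nat.suc (toℕ y)))
lemma6p6 n σ y y∈F y∈G′ = count≡height+1 , rise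
  where
  rise : height σ (toℕ y) + + 1 ≡ height σ (suc (toℕ y))
  rise = sym (trans (height-suc σ y) (cong (_+_ (height σ (toℕ y))) (step-valley σ (y∈G′ , y∈F))))

  count≡height+1 : + count (Counted? σ y) ≡ height σ (toℕ y) + + 1
  count≡height+1 = begin
    + count (Counted? σ y)
      ≡⟨ cong (+_ ∘ length) (filter-≐ (Counted? σ y) (Straddles? σ (suc (toℕ y))) (Counted≐Straddles σ y) (allFin n)) ⟩
    + count (Straddles? σ (suc (toℕ y)))
      ≡⟨ sym (height≡count-Straddles σ (suc (toℕ y)) (toℕ<n y)) ⟩
    height σ (suc (toℕ y))
      ≡⟨ sym rise ⟩
    height σ (toℕ y) + + 1
      ∎
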